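{- Let $(S,*)$ be an adequate partial semigroup, let $k\in\mathbb{N}$, and let $A$ be a $2k$-CR set in $S$. Then $A\times A$ is a $k$-CR set in $S\times S$. In particular, if $A$ is a CR set in $S$, then $A\times A$ is a CR set in $S\times S$.
   Context: A partial semigroup is a pair $(S,*)$ where $S$ is a nonempty set and $*$ is an operation defined on a nonempty subset of $S\times S$ such that for all $x,y,z\in S$, $(x*y)*z=x*(y*z)$ in the sense that if either side is defined then so is the other and they are equal. $S\times S$ is the partial semigroup with $(a,b)*(c,d)=(a*c,b*d)$ defined iff $a*c$ and $b*d$ are both defined. For $a\in S$, $\varphi(a)=\{b\in S: a*b \text{ is defined}\}$; for finite nonempty $F\subseteq S$, $\sigma(F)=\bigcap_{a\in F}\varphi(a)$. $(S,*)$ is adequate if $\sigma(F)\neq\emptyset$ for all finite nonempty $F$. $\mathcal{P}_f(X)$ denotes the set of finite nonempty subsets of $X$. Products $\prod_{t\in H}f(t)$ are computed in increasing order of indices. In an adequate partial semigroup $S$, a sequence $f:\mathbb{N}\to S$ is adequate if (i) for each $H\in\mathcal{P}_f(\mathbb{N})$, $\prod_{t\in H}f(t)$ is defined, and (ii) for each $F\in\mathcal{P}_f(S)$ there is $m\in\mathbb{N}$ such that $\prod_{t\in H}f(t)\in\sigma(F)$ for all $H\in\mathcal{P}_f(\mathbb{N})$ with $\min H\geq m$. $\mathcal{T}_S$ denotes the set of adequate sequences in $S$, and $\mathcal{P}_f(\mathcal{T}_S)_{\leq k}=\{F\in\mathcal{P}_f(\mathcal{T}_S): |F|\leq k\}$.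 For $k\in\mathbb{N}$, $A\subseteq S$ is a $k$-CR set in $S$ if for every $L\in\mathcal{P}_f(S)$ there is $r\in\mathbb{N}$ such that for every $F\in\mathcal{P}_f(\mathcal{T}_S)_{\leq k}$ there exist $m\in\mathbb{N}$, $a\in S^{m+1}$ and $t(1)<\dots<t(m)\leq r$ in $\mathbb{N}$ such that for all $f\in F$, $a(1)*f(t(1))*a(2)*\dots*a(m)*f(t(m))*a(m+1)$ is defined and lies in $A\cap\sigma(L)$; $A$ is a CR set if it is $k$-CR for all $k$. (The same definitions apply in $S\times S$.) -}

module Defs where

open import Level using (0ℓ)
open import Data.Nat using (ℕ; zero; suc; _≤_; _<_; _*_)
open import Data.Product using (Σ; ∃; _×_; _,_; proj₁; proj₂)
open import Data.Maybe using (Maybe; just; nothing; _>>=_)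
open import Data.List using (List; []; _∷_; length)
open import Data.List.NonEmpty using (List⁺; _∷_; toList; head) renaming (map to map⁺; length to length⁺)
open import Data.List.Relation.Unary.All using (All)
open import Data.List.Relation.Unary.Linked using (Linked)
open import Data.Vec using (Vec; []; _∷_)
open import Relation.Binary.PropositionalEquality using (_≡_; refl; cong)

Defined : {A : Set} → Maybe A → Set
Defined {A} m = Σ A λ a → m ≡ just a

-- Associativity "(x*y)*z = x*(y*z), either side defined iff the other is,
-- and then equal" is exactly equality of the two Kleisli composites.
record PartialSemigroup : Set₁ where
  field
    Carrier   : Set
    _⋆_       : Carrier → Carrier → Maybe Carrier
    assoc     : ∀ x y z → ((x ⋆ y) >>= λ u → u ⋆ z) ≡ ((y ⋆ z) >>= λ v → x ⋆ v)
    domNonempty : Σ Carrier λ x → Σ Carrier λ y → Defined (x ⋆ y)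

module _ (S : PartialSemigroup) where
  open PartialSemigroup S

  Inσ : List⁺ Carrier → Carrier → Set
  Inσ F b = All (λ a → Defined (a ⋆ b)) (toList F)

  IsAdequate : Set
  IsAdequate = (F : List⁺ Carrier) → Σ Carrier (Inσ F)

  -- left-to-right product  s * x₁ * x₂ * ... * xₙ  (well-defined by associativity)
  prodFrom : Carrier → List Carrier → Maybe Carrier
  prodFrom s []       = just s
  prodFrom s (x ∷ xs) = (s ⋆ x) >>= λ u → prodFrom u xs

  prod⁺ : List⁺ Carrier → Maybe Carrier
  prod⁺ (x ∷ xs) = prodFrom x xs

  -- finite nonempty subsets H of ℕ, listed in strictly increasing order
  -- (so min H = head H and products are taken in increasing order of indices)
  FinSetℕ : Set
  FinSetℕ = Σ (List⁺ ℕ) λ H → Linked _<_ (toList H)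

  seqProd : (ℕ → Carrier) → FinSetℕ → Maybe Carrier
  seqProd f (H , _) = prod⁺ (map⁺ f H)

  IsAdequateSeq : (ℕ → Carrier) → Set
  IsAdequateSeq f =
    ((H : FinSetℕ) → Defined (seqProd f H)) ×
    ((F : List⁺ Carrier) → Σ ℕ λ m → (H : FinSetℕ) → m ≤ head (proj₁ H) →
        Σ Carrier λ s → seqProd f H ≡ just s × Inσ F s)

  AdequateSeq : Set
  AdequateSeq = Σ (ℕ → Carrier) IsAdequateSeq

  IncrBoundedBy : ℕ → {m : ℕ} → Vec ℕ m → Set
  IncrBoundedBy r []           = Data.Unit.⊤ where import Data.Unit
  IncrBoundedBy r (t ∷ [])     = t ≤ r
  IncrBoundedBy r (t ∷ u ∷ ts) = t < u × IncrBoundedBy r (u ∷ ts)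

  word : {m : ℕ} → Vec Carrier (suc m) → Vec ℕ m → (ℕ → Carrier) → List⁺ Carrier
  word (a ∷ [])     []       f = a ∷ []
  word (a ∷ b ∷ as) (t ∷ ts) f = a ∷ (f t ∷ toList (word (b ∷ as) ts f))

  -- A is a k-CR set in S.  F ∈ 𝒫_f(𝒯_S) with |F| ≤ k is given as a nonempty
  -- list of adequate sequences of length ≤ k.  m ranges over ℕ = {1,2,...}.
  IsKCR : ℕ → (Carrier → Set) → Set
  IsKCR k A =
    (L : List⁺ Carrier) → Σ ℕ λ r →
    (F : List⁺ AdequateSeq) → length⁺ F ≤ k →
    Σ ℕ λ m → 1 ≤ m × Σ (Vec Carrier (suc m)) λ a → Σ (Vec ℕ m) λ t →
      IncrBoundedBy r t ×
      All (λ f → Σ Carrier λ s → prod⁺ (word a t (proj₁ f)) ≡ just s × A s × Inσ L s)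
          (toList F)

  IsCR : (Carrier → Set) → Set
  IsCR A = (k : ℕ) → IsKCR k A

pairM : {A B : Set} → Maybe A → Maybe B → Maybe (A × B)
pairM (just a) (just b) = just (a , b)
pairM _        _        = nothing

private
  pairM-nothingʳ : {A B : Set} (m : Maybe A) → pairM {A} {B} m nothing ≡ nothing
  pairM-nothingʳ (just _) = refl
  pairM-nothingʳ nothing  = refl

  pairM-bind : {A B C D : Set} (m₁ : Maybe A) (m₂ : Maybe B) (f : A → Maybe C) (g : B → Maybe D) →
    (pairM m₁ m₂ >>= λ p → pairM (f (proj₁ p)) (g (proj₂ p))) ≡ pairM (m₁ >>= f) (m₂ >>= g)
  pairM-bind nothing  m₂        f g = refl
  pairM-bind (just a) nothing   f g = Relation.Binary.PropositionalEquality.sym (pairM-nothingʳ (f a))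
    where import Relation.Binary.PropositionalEquality
  pairM-bind (just a) (just b)  f g = refl

_×ₚ_ : PartialSemigroup → PartialSemigroup → PartialSemigroup
S ×ₚ T = record
  { Carrier = S.Carrier × T.Carrier
  ; _⋆_ = λ x y → pairM (proj₁ x S.⋆ proj₁ y) (proj₂ x T.⋆ proj₂ y)
  ; assoc = λ x y z →
      Relation.Binary.PropositionalEquality.trans
        (pairM-bind (proj₁ x S.⋆ proj₁ y) (proj₂ x T.⋆ proj₂ y) (λ u → u S.⋆ proj₁ z) (λ u → u T.⋆ proj₂ z))
        (Relation.Binary.PropositionalEquality.trans
          (Relation.Binary.PropositionalEquality.cong₂ pairM (S.assoc _ _ _) (T.assoc _ _ _))
          (Relation.Binary.PropositionalEquality.sym
            (pairM-bind (proj₁ y S.⋆ proj₁ z) (proj₂ y T.⋆ proj₂ z) (λ v → proj₁ x S.⋆ v) (λ v → proj₂ x T.⋆ v))))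
  ; domNonempty = dn S.domNonempty T.domNonempty
  }
  where
    import Relation.Binary.PropositionalEquality
    module S = PartialSemigroup S
    module T = PartialSemigroup T
    dn : _ → _ → _
    dn (x , y , u , p) (x' , y' , u' , p') =
      (x , x') , (y , y') , (u , u') ,
      Relation.Binary.PropositionalEquality.cong₂ pairM p p' where
        import Relation.Binary.PropositionalEquality

-- The product operation acts coordinatewise, so a word in S × S whose fixed letters lie on the
-- diagonal evaluates to the pair of the two coordinate words in S.  Given finitely many adequate
-- sequences in S × S (at most k of them), split each into its two coordinate sequences, which are
-- adequate in S; the 2k-CR property of A yields one choice of diagonal letters a and indices t
-- making every coordinate word land in A ∩ σ(L'), where L' lists all coordinates of the pairs in L.
-- Pairing the coordinates back up gives words in (A × A) ∩ σ(L).
module Submission where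

open import Defs
open import Function using (_∘_; _∘₂_)
open import Data.Nat using (ℕ; suc; _≤_; _*_)
open import Data.Nat.Properties using (*-suc; *-monoʳ-≤; ≤-reflexive; ≤-trans)
open import Data.Product using (Σ; _×_; _,_; proj₁; proj₂; uncurry)
open import Data.Maybe using (Maybe; just; nothing)
open import Data.List as List using (List; []; _∷_; length)
open import Data.List.NonEmpty using (List⁺; _∷_; toList; head) renaming (map to map⁺; length to length⁺)
import Data.List.NonEmpty.Properties as List⁺
open import Data.List.Relation.Unary.All as All using (All; []; _∷_)
import Data.List.Relation.Unary.All.Properties as All
open import Data.Vec using (Vec; []; _∷_)
import Data.Vec as Vec
import Data.Vec.Properties as Vec
open import Relation.Binary.PropositionalEquality using (_≡_; refl; sym; trans; cong; cong₂)

_×̇_ : {X : Set} → (X → Set) → (X → Set) → X × X → Set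
(P ×̇ Q) p = P (proj₁ p) × Q (proj₂ p)

pairM-nothingʳ : {X Y : Set} (m : Maybe X) → pairM {X} {Y} m nothing ≡ nothing
pairM-nothingʳ (just _) = refl
pairM-nothingʳ nothing  = refl

pairM-just⁻ : {X Y : Set} (m₁ : Maybe X) (m₂ : Maybe Y) {a : X} {b : Y} →
  pairM m₁ m₂ ≡ just (a , b) → m₁ ≡ just a × m₂ ≡ just b
pairM-just⁻ (just _) (just _) refl = refl , refl
pairM-just⁻ (just _) nothing  ()
pairM-just⁻ nothing  _        ()

pairM-Defined⁺ : {X Y : Set} {m₁ : Maybe X} {m₂ : Maybe Y} →
  Defined m₁ → Defined m₂ → Defined (pairM m₁ m₂)
pairM-Defined⁺ (a , refl) (b , refl) = (a , b) , refl

pairM-Defined⁻ : {X Y : Set} (m₁ : Maybe X) (m₂ : Maybe Y) →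
  Defined (pairM m₁ m₂) → Defined m₁ × Defined m₂
pairM-Defined⁻ m₁ m₂ ((a , b) , eq) = let (eq₁ , eq₂) = pairM-just⁻ m₁ m₂ eq in (a , eq₁) , (b , eq₂)

flattenPairs : {X : Set} → List (X × X) → List X
flattenPairs []             = []
flattenPairs ((a , b) ∷ xs) = a ∷ b ∷ flattenPairs xs

flattenPairs⁺ : {X : Set} → List⁺ (X × X) → List⁺ X
flattenPairs⁺ ((a , b) ∷ xs) = a ∷ (b ∷ flattenPairs xs)

length-flattenPairs : {X : Set} (xs : List (X × X)) → length (flattenPairs xs) ≡ 2 * length xs
length-flattenPairs []       = refl
length-flattenPairs (_ ∷ xs) = trans (cong (suc ∘ suc) (length-flattenPairs xs)) (sym (*-suc 2 (length xs)))

length-flattenPairs⁺ : {X : Set} (xs : List⁺ (X × X)) → length⁺ (flattenPairs⁺ xs) ≡ 2 * length⁺ xs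
length-flattenPairs⁺ (x ∷ xs) = length-flattenPairs (x ∷ xs)

All-flattenPairs⁻ : {X : Set} {P : X → Set} (xs : List (X × X)) →
  All P (flattenPairs xs) → All (P ×̇ P) xs
All-flattenPairs⁻ []             []               = []
All-flattenPairs⁻ ((_ , _) ∷ xs) (pa ∷ pb ∷ pxs) = (pa , pb) ∷ All-flattenPairs⁻ xs pxs

All-flattenPairs⁺⁻ : {X : Set} {P : X → Set} (xs : List⁺ (X × X)) →
  All P (toList (flattenPairs⁺ xs)) → All (P ×̇ P) (toList xs)
All-flattenPairs⁺⁻ (x ∷ xs) = All-flattenPairs⁻ (x ∷ xs)

-- IncrBoundedBy never uses its semigroup parameter, but it is not definitionally independent of it.
IncrBoundedBy-transfer : (S T : PartialSemigroup) (r : ℕ) {m : ℕ} (t : Vec ℕ m) →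
  IncrBoundedBy S r t → IncrBoundedBy T r t
IncrBoundedBy-transfer S T r []            p       = p
IncrBoundedBy-transfer S T r (_ ∷ [])      p       = p
IncrBoundedBy-transfer S T r (_ ∷ u ∷ ts) (p , q) = p , IncrBoundedBy-transfer S T r (u ∷ ts) q

map⁺-word : (S T : PartialSemigroup) (g : PartialSemigroup.Carrier S → PartialSemigroup.Carrier T)
  {m : ℕ} (a : Vec (PartialSemigroup.Carrier S) (suc m)) (t : Vec ℕ m) (f : ℕ → PartialSemigroup.Carrier S) →
  map⁺ g (word S a t f) ≡ word T (Vec.map g a) t (g ∘ f)
map⁺-word S T g (a ∷ [])     []       f = refl
map⁺-word S T g (a ∷ b ∷ as) (t ∷ ts) f = cong (λ w → g a ∷ (g (f t) ∷ toList w)) (map⁺-word S T g (b ∷ as) ts f)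

module _ (S : PartialSemigroup) where
  open PartialSemigroup S

  LandsIn : (A : Carrier → Set) (L : List⁺ Carrier) {m : ℕ} → Vec Carrier (suc m) → Vec ℕ m → (ℕ → Carrier) → Set
  LandsIn A L a t f = Σ Carrier λ s → prod⁺ S (word S a t f) ≡ just s × A s × Inσ S L s

  CRWitness : (r : ℕ) (A : Carrier → Set) (L : List⁺ Carrier) (F : List⁺ (AdequateSeq S)) → Set
  CRWitness r A L F = Σ ℕ λ m → 1 ≤ m × Σ (Vec Carrier (suc m)) λ a → Σ (Vec ℕ m) λ t →
    IncrBoundedBy S r t × All (λ f → LandsIn A L a t (proj₁ f)) (toList F)

module Coordinatewise (S T : PartialSemigroup) where
  private
    module S = PartialSemigroup S
    module T = PartialSemigroup T

  prodFrom-× : (x₁ : S.Carrier) (x₂ : T.Carrier) (xs : List (S.Carrier × T.Carrier)) →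
    prodFrom (S ×ₚ T) (x₁ , x₂) xs
      ≡ pairM (prodFrom S x₁ (List.map proj₁ xs)) (prodFrom T x₂ (List.map proj₂ xs))
  prodFrom-× x₁ x₂ []               = refl
  prodFrom-× x₁ x₂ ((y₁ , y₂) ∷ ys) with x₁ S.⋆ y₁ | x₂ T.⋆ y₂
  ... | just u₁ | just u₂ = prodFrom-× u₁ u₂ ys
  ... | just u₁ | nothing = sym (pairM-nothingʳ (prodFrom S u₁ (List.map proj₁ ys)))
  ... | nothing | _       = refl

  prod⁺-× : (xs : List⁺ (S.Carrier × T.Carrier)) →
    prod⁺ (S ×ₚ T) xs ≡ pairM (prod⁺ S (map⁺ proj₁ xs)) (prod⁺ T (map⁺ proj₂ xs))
  prod⁺-× ((x₁ , x₂) ∷ xs) = prodFrom-× x₁ x₂ xs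

  seqProd-× : (f : ℕ → S.Carrier × T.Carrier) (H : FinSetℕ (S ×ₚ T)) →
    seqProd (S ×ₚ T) f H ≡ pairM (seqProd S (proj₁ ∘ f) H) (seqProd T (proj₂ ∘ f) H)
  seqProd-× f (H , _) =
    trans (prod⁺-× (map⁺ f H))
          (sym (cong₂ pairM (cong (prod⁺ S) (List⁺.map-∘ H)) (cong (prod⁺ T) (List⁺.map-∘ H))))

  seqProd-×-just⁻ : (f : ℕ → S.Carrier × T.Carrier) (H : FinSetℕ (S ×ₚ T)) {u : S.Carrier × T.Carrier} →
    seqProd (S ×ₚ T) f H ≡ just u →
    seqProd S (proj₁ ∘ f) H ≡ just (proj₁ u) × seqProd T (proj₂ ∘ f) H ≡ just (proj₂ u)
  seqProd-×-just⁻ f H eq = pairM-just⁻ _ _ (trans (sym (seqProd-× f H)) eq)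

module Square (S : PartialSemigroup) where
  open PartialSemigroup S
  open Coordinatewise S S

  diag : Carrier → Carrier × Carrier
  diag x = x , x

  Inσ-diag⁻ : (F : List⁺ Carrier) (s : Carrier × Carrier) →
    Inσ (S ×ₚ S) (map⁺ diag F) s → Inσ S F (proj₁ s) × Inσ S F (proj₂ s)
  Inσ-diag⁻ (x ∷ xs) (s₁ , s₂) p =
    All.unzip (All.map (λ {a} → pairM-Defined⁻ (a ⋆ s₁) (a ⋆ s₂)) (All.map⁻ p))

  Inσ-flattenPairs⁻ : (L : List⁺ (Carrier × Carrier)) {s₁ s₂ : Carrier} →
    Inσ S (flattenPairs⁺ L) s₁ → Inσ S (flattenPairs⁺ L) s₂ → Inσ (S ×ₚ S) L (s₁ , s₂)
  Inσ-flattenPairs⁻ L σ₁ σ₂ =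
    All.zipWith (λ ((d₁ , _) , (_ , d₂)) → pairM-Defined⁺ d₁ d₂)
                (All-flattenPairs⁺⁻ L σ₁ , All-flattenPairs⁺⁻ L σ₂)

  prod⁺-word-diag : {m : ℕ} (a : Vec Carrier (suc m)) (t : Vec ℕ m) (f : ℕ → Carrier × Carrier) →
    prod⁺ (S ×ₚ S) (word (S ×ₚ S) (Vec.map diag a) t f)
      ≡ pairM (prod⁺ S (word S a t (proj₁ ∘ f))) (prod⁺ S (word S a t (proj₂ ∘ f)))
  prod⁺-word-diag a t f =
    trans (prod⁺-× (word (S ×ₚ S) (Vec.map diag a) t f))
          (cong₂ pairM (cong (prod⁺ S) (coordinate proj₁ (λ _ → refl)))
                       (cong (prod⁺ S) (coordinate proj₂ (λ _ → refl))))
    where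
      coordinate : (π : Carrier × Carrier → Carrier) → (∀ x → π (diag x) ≡ x) →
        map⁺ π (word (S ×ₚ S) (Vec.map diag a) t f) ≡ word S a t (π ∘ f)
      coordinate π π∘diag≗id =
        trans (map⁺-word (S ×ₚ S) S π (Vec.map diag a) t f)
              (cong (λ b → word S b t (π ∘ f))
                    (trans (sym (Vec.map-∘ π diag a)) (trans (Vec.map-cong π∘diag≗id a) (Vec.map-id a))))

  isAdequateSeq-× : (f : ℕ → Carrier × Carrier) → IsAdequateSeq (S ×ₚ S) f →
    IsAdequateSeq S (proj₁ ∘ f) × IsAdequateSeq S (proj₂ ∘ f)
  isAdequateSeq-× f (defined , eventuallyInσ) =
    (proj₁ ∘ defined-× , proj₁ ∘ eventuallyInσ-×) , (proj₂ ∘ defined-× , proj₂ ∘ eventuallyInσ-×)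
    where
      defined-× : (H : FinSetℕ S) →
        Defined (seqProd S (proj₁ ∘ f) H) × Defined (seqProd S (proj₂ ∘ f) H)
      defined-× H with defined H
      ... | (u₁ , u₂) , eq = let (eq₁ , eq₂) = seqProd-×-just⁻ f H eq in (u₁ , eq₁) , (u₂ , eq₂)

      EventuallyInσ : (ℕ → Carrier) → List⁺ Carrier → ℕ → Set
      EventuallyInσ g F m = (H : FinSetℕ S) → m ≤ head (proj₁ H) →
        Σ Carrier λ s → seqProd S g H ≡ just s × Inσ S F s

      eventuallyInσ-× : (F : List⁺ Carrier) →
        Σ ℕ (EventuallyInσ (proj₁ ∘ f) F) × Σ ℕ (EventuallyInσ (proj₂ ∘ f) F)
      eventuallyInσ-× F with eventuallyInσ (map⁺ diag F)
      ... | m , later = (m , proj₁ ∘₂ coordinates) , (m , proj₂ ∘₂ coordinates)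
        where
          coordinates : (H : FinSetℕ S) → m ≤ head (proj₁ H) →
            (Σ Carrier λ s → seqProd S (proj₁ ∘ f) H ≡ just s × Inσ S F s) ×
            (Σ Carrier λ s → seqProd S (proj₂ ∘ f) H ≡ just s × Inσ S F s)
          coordinates H m≤H with later H m≤H
          ... | (s₁ , s₂) , eq , σs =
            let (eq₁ , eq₂) = seqProd-×-just⁻ f H eq
                (σ₁ , σ₂) = Inσ-diag⁻ F (s₁ , s₂) σs
            in (s₁ , eq₁ , σ₁) , (s₂ , eq₂ , σ₂)

  coordinateSeqs : AdequateSeq (S ×ₚ S) → AdequateSeq S × AdequateSeq S
  coordinateSeqs (f , adequate) = let (adequate₁ , adequate₂) = isAdequateSeq-× f adequate in
    (proj₁ ∘ f , adequate₁) , (proj₂ ∘ f , adequate₂)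

  length-coordinateSeqs≤ : (k : ℕ) (F : List⁺ (AdequateSeq (S ×ₚ S))) → length⁺ F ≤ k →
    length⁺ (flattenPairs⁺ (map⁺ coordinateSeqs F)) ≤ 2 * k
  length-coordinateSeqs≤ k F |F|≤k = ≤-trans
    (≤-reflexive (trans (length-flattenPairs⁺ (map⁺ coordinateSeqs F))
                        (cong (2 *_) (List⁺.length-map coordinateSeqs F))))
    (*-monoʳ-≤ 2 |F|≤k)

  landsIn-diag : (A : Carrier → Set) (L : List⁺ (Carrier × Carrier))
    {m : ℕ} (a : Vec Carrier (suc m)) (t : Vec ℕ m) (f : ℕ → Carrier × Carrier) →
    LandsIn S A (flattenPairs⁺ L) a t (proj₁ ∘ f) → LandsIn S A (flattenPairs⁺ L) a t (proj₂ ∘ f) →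
    LandsIn (S ×ₚ S) (A ×̇ A) L (Vec.map diag a) t f
  landsIn-diag A L a t f (s₁ , eq₁ , A₁ , σ₁) (s₂ , eq₂ , A₂ , σ₂) =
    (s₁ , s₂) , trans (prod⁺-word-diag a t f) (cong₂ pairM eq₁ eq₂) , (A₁ , A₂) , Inσ-flattenPairs⁻ L σ₁ σ₂

  crWitness-diag : (r : ℕ) (A : Carrier → Set) (L : List⁺ (Carrier × Carrier)) (F : List⁺ (AdequateSeq (S ×ₚ S))) →
    CRWitness S r A (flattenPairs⁺ L) (flattenPairs⁺ (map⁺ coordinateSeqs F)) →
    CRWitness (S ×ₚ S) r (A ×̇ A) L F
  crWitness-diag r A L F (m , 1≤m , a , t , t≤r , landsIn) =
    m , 1≤m , Vec.map diag a , t , IncrBoundedBy-transfer S (S ×ₚ S) r t t≤r ,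
    All.map (λ {f} → uncurry (landsIn-diag A L a t (proj₁ f)))
            (All.map⁻ (All-flattenPairs⁺⁻ (map⁺ coordinateSeqs F) landsIn))

  isKCR-× : (k : ℕ) (A : Carrier → Set) → IsKCR S (2 * k) A → IsKCR (S ×ₚ S) k (A ×̇ A)
  isKCR-× k A kcr L =
    let (r , choose) = kcr (flattenPairs⁺ L) in
    r , λ F |F|≤k → crWitness-diag r A L F
                      (choose (flattenPairs⁺ (map⁺ coordinateSeqs F)) (length-coordinateSeqs≤ k F |F|≤k))

theorem4p3 : (S : PartialSemigroup) → IsAdequate S →
    ((k : ℕ) (A : PartialSemigroup.Carrier S → Set) →
      IsKCR S (2 * k) A → IsKCR (S ×ₚ S) k (λ p → A (proj₁ p) × A (proj₂ p)))
    × ((A : PartialSemigroup.Carrier S → Set) →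
      IsCR S A → IsCR (S ×ₚ S) (λ p → A (proj₁ p) × A (proj₂ p)))
theorem4p3 S _ = isKCR-× , λ A cr k → isKCR-× k A (cr (2 * k))
  where open Square S
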